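{- Let $\rho,\tau\in\mathbb{N}$, let $G$ be a graph and let $P=x_0 - x_1 - \cdots - x_{\tau^\rho}$ be a path of length $\tau^\rho$ that is a (not necessarily induced) subgraph of $G$. Then one of the following holds: (a) there exists $i_0\in\{0,\dots,\tau^\rho\}$ such that $x_{i_0}$ is adjacent in $G$ to at least $\tau$ vertices in $\{x_i: i_0+1\le i\le\tau^\rho\}$; (b) there are $j_0,j_1,\dots,j_\rho\in\{0,\dots,\tau^\rho\}$ with $0=j_0<j_1<\cdots<j_\rho$ such that the edges of $G[\{x_{j_0},\dots,x_{j_\rho}\}]$ are exactly $\{x_{j_{k-1}}x_{j_k}:1\le k\le\rho\}$, i.e., $x_0 - x_{j_1} - \cdots - x_{j_\rho}$ is an induced path in $G$.
   Context: Graphs are finite and simple; $\mathbb{N}$ is the positive integers. $x_0 - x_1 - \cdots - x_n$ denotes the path with edges $x_{i}x_{i+1}$; its length is its number of edges. $G[X]$ is the subgraph of $G$ induced by $X$. -}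

module Defs where

open import Level using (0ℓ)
open import Data.Nat using (ℕ; suc; _+_; _<_)
open import Data.Fin using (Fin; toℕ; inject₁) renaming (suc to fsuc)
open import Data.Empty using (⊥)
open import Data.Product using (_×_)
open import Data.Sum using (_⊎_)
open import Relation.Nullary using (¬_)
open import Relation.Binary.PropositionalEquality using (_≡_)
open import Relation.Binary.Definitions using (Decidable; Symmetric)
open import Function.Definitions using (Injective)

-- A finite simple graph on the vertex set Fin n: an irreflexive, symmetric,
-- decidable adjacency relation (decidability is automatic classically for
-- finite graphs).
record Graph : Set₁ where
  field
    n     : ℕ
    Adj   : Fin n → Fin n → Set
    dec   : Decidable Adj
    sym   : Symmetric Adj
    irrefl : ∀ v → ¬ Adj v v

open Graph public

IsPath : (G : Graph) (L : ℕ) → (Fin (suc L) → Fin (n G)) → Set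
IsPath G L x =
  Injective _≡_ _≡_ x × (∀ (i : Fin L) → Adj G (x (inject₁ i)) (x (fsuc i)))

{-# OPTIONS --safe #-}
module Submission where

-- Induction on d: from every position a with a + τ^d ≤ L, either some vertex has τ later
-- neighbours, or an induced path with d edges starts at a and stays within [a, a + τ^d].
-- For the step, walk greedily through the neighbours of a, starting at a + 1 and each time
-- jumping to a next neighbour at most τ^d further on. Either τ neighbours are found within
-- a + τ^(d+1), or the walk stops at a neighbour c of a with no neighbour of a in (c, c + τ^d];
-- then the induced path from c given by induction extends by a, which sees only its first vertex.

open import Defs
open import Data.Nat using (ℕ; suc; _+_; _<_; _≤_; _^_)
open import Data.Fin using (Fin; toℕ; zero)
open import Data.Product using (Σ; _×_; ∃)
open import Data.Sum using (_⊎_)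
open import Function.Bundles using (_⇔_)
open import Function.Definitions using (Injective)
open import Relation.Binary.PropositionalEquality using (_≡_)

open import Data.Nat using (zero; _*_; z≤n; s≤s; _<?_)
open import Data.Nat.Properties
open import Data.Nat.DivMod using (_mod_; m≤n⇒m%n≡m)
open import Data.Fin using (fromℕ<; inject₁) renaming (suc to fsuc)
open import Data.Fin.Properties using (toℕ-injective; toℕ-fromℕ<; toℕ-inject₁; toℕ≤pred[n])
open import Data.Product using (_,_; ∃₂)
open import Data.Sum using (inj₁; inj₂; swap; map₁; map₂) renaming (map to ⊎-map)
open import Data.Vec.Functional using (_∷_)
open import Function.Base using (_∘_)
open import Function.Bundles using (mk⇔)
open import Function.Construct.Composition using (_⇔-∘_)
open import Function.Construct.Symmetry using (⇔-sym)
open import Relation.Binary.Definitions using (Decidable; Symmetric)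
open import Relation.Nullary using (¬_; yes; no; contradiction)
open import Relation.Binary using (tri<; tri≈; tri>)
open import Relation.Nullary.Decidable using (_×-dec_)
open import Relation.Binary.PropositionalEquality
  using (refl; trans; cong; subst; subst₂)
  renaming (sym to ≡-sym)

Increasing : ∀ {m} → (Fin m → ℕ) → Set
Increasing F = ∀ k l → toℕ k < toℕ l → F k < F l

∷-increasing : ∀ {m a} {F : Fin m → ℕ} → (∀ k → a < F k) → Increasing F → Increasing (a ∷ F)
∷-increasing a<F inc zero     (fsuc l) _         = a<F l
∷-increasing a<F inc (fsuc k) (fsuc l) (s≤s k<l) = inc k l k<l

increasing⇒injective : ∀ {m} {F : Fin m → ℕ} → Increasing F → Injective _≡_ _≡_ F
increasing⇒injective inc {k} {l} Fk≡Fl with <-cmp (toℕ k) (toℕ l)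
... | tri< k<l _ _ = contradiction Fk≡Fl (<⇒≢ (inc k l k<l))
... | tri≈ _ k≡l _ = toℕ-injective k≡l
... | tri> _ _ l<k = contradiction (≡-sym Fk≡Fl) (<⇒≢ (inc l k l<k))

record Ascending (t c b : ℕ) : Set where
  field
    at         : Fin (suc t) → ℕ
    at-zero    : at zero ≡ c
    increasing : Increasing at
    bounded    : ∀ k → at k ≤ b

  start<at-suc : ∀ k → c < at (fsuc k)
  start<at-suc k = subst (_< at (fsuc k)) at-zero (increasing zero (fsuc k) (s≤s z≤n))

  start≤at : ∀ k → c ≤ at k
  start≤at zero     = ≤-reflexive (≡-sym at-zero)
  start≤at (fsuc k) = <⇒≤ (start<at-suc k)

open Ascending

weaken : ∀ {t c b b′} → b ≤ b′ → Ascending t c b → Ascending t c b′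
weaken b≤b′ A = record
  { at = at A ; at-zero = at-zero A ; increasing = increasing A ; bounded = λ k → ≤-trans (bounded A k) b≤b′ }

singleton : ∀ {c b} → c ≤ b → Ascending 0 c b
singleton {c} c≤b = record
  { at = λ _ → c ; at-zero = refl ; increasing = λ { zero zero () } ; bounded = λ _ → c≤b }

prepend : ∀ {t a c b} → a < c → Ascending t c b → Ascending (suc t) a b
prepend {a = a} a<c A = record
  { at         = a ∷ at A
  ; at-zero    = refl
  ; increasing = ∷-increasing (λ k → <-≤-trans a<c (start≤at A k)) (increasing A)
  ; bounded    = λ { zero → <⇒≤ (<-≤-trans a<c (≤-trans (start≤at A zero) (bounded A zero)))
                 ; (fsuc k) → bounded A k }
  }

Consecutive : ∀ {m} → Fin m → Fin m → Set
Consecutive k l = suc (toℕ k) ≡ toℕ l ⊎ suc (toℕ l) ≡ toℕ k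

Consecutive-sym : ∀ {m} {k l : Fin m} → Consecutive k l ⇔ Consecutive l k
Consecutive-sym = mk⇔ swap swap

Consecutive-suc : ∀ {m} {k l : Fin m} → Consecutive (fsuc k) (fsuc l) ⇔ Consecutive k l
Consecutive-suc = mk⇔ (⊎-map suc-injective suc-injective) (⊎-map (cong suc) (cong suc))

¬Consecutive-refl : ∀ {m} {k : Fin m} → ¬ Consecutive k k
¬Consecutive-refl (inj₁ 1+k≡k) = 1+n≢n 1+k≡k
¬Consecutive-refl (inj₂ 1+k≡k) = 1+n≢n 1+k≡k

¬Consecutive-zero-suc-suc : ∀ {m} {l : Fin m} → ¬ Consecutive {suc (suc m)} zero (fsuc (fsuc l))
¬Consecutive-zero-suc-suc (inj₁ ())
¬Consecutive-zero-suc-suc (inj₂ ())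

module _ (R : ℕ → ℕ → Set) where

  NoNeighbourIn : ℕ → ℕ → ℕ → Set
  NoNeighbourIn a c e = ∀ {m} → c < m → m ≤ e → ¬ R a m

  NeighbourChain : ℕ → ℕ → ℕ → ℕ → Set
  NeighbourChain a t c b = Σ (Ascending t c b) λ A → ∀ k → R a (at A k)

  InducedPath : ℕ → ℕ → ℕ → Set
  InducedPath d a b = Σ (Ascending d a b) λ A → ∀ k l → R (at A k) (at A l) ⇔ Consecutive k l

  record NeighbourBeforeGap (a T b : ℕ) : Set where
    field
      neighbour : ℕ
      later     : a < neighbour
      room      : neighbour + T ≤ b
      adjacent  : R a neighbour
      gap       : NoNeighbourIn a neighbour (neighbour + T)

  ManyLaterNeighbours : ℕ → ℕ → Set
  ManyLaterNeighbours t b = ∃₂ λ a c → a < c × NeighbourChain a t c b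

module _ {R : ℕ → ℕ → Set} (R? : Decidable R) (R-sym : Symmetric R) (R-irrefl : ∀ i → ¬ R i i) where

  loop-free : ∀ {m} i (k : Fin m) → R i i ⇔ Consecutive k k
  loop-free i k =
    mk⇔ (λ Rii → contradiction Rii (R-irrefl i)) (λ cons → contradiction cons ¬Consecutive-refl)

  nextNeighbour : ∀ a c e → (∃ λ m → c < m × m ≤ e × R a m) ⊎ NoNeighbourIn R a c e
  nextNeighbour a c e with anyUpTo? (λ m → (c <? m) ×-dec R? a m) (suc e)
  ... | yes (m , s≤s m≤e , c<m , Ram) = inj₁ (m , c<m , m≤e , Ram)
  ... | no none = inj₂ λ c<m m≤e Ram → none (_ , s≤s m≤e , c<m , Ram)

  neighbourChainOrGap : ∀ s′ {a c b} T → a < c → R a c → c + s′ * T ≤ b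
                      → NeighbourChain R a s′ c b ⊎ NeighbourBeforeGap R a T b
  neighbourChainOrGap zero {c = c} T a<c Rac room =
    inj₁ (singleton (≤-trans (m≤m+n c _) room) , λ _ → Rac)
  neighbourChainOrGap (suc s′) {a} {c} {b} T a<c Rac room with nextNeighbour a c (c + T)
  ... | inj₂ gap = inj₂ record
    { neighbour = c ; later = a<c ; adjacent = Rac ; gap = gap
    ; room = ≤-trans (+-monoʳ-≤ c (m≤m+n T (s′ * T))) room }
  ... | inj₁ (m , c<m , m≤c+T , Ram) =
    map₁ (λ (A , adj) → prepend c<m A , λ { zero → Rac ; (fsuc k) → adj k })
          (neighbourChainOrGap s′ T (<-trans a<c c<m) Ram m+s′T≤b)
    where
    open ≤-Reasoning
    m+s′T≤b : m + s′ * T ≤ b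
    m+s′T≤b = begin
      m + s′ * T       ≤⟨ +-monoˡ-≤ (s′ * T) m≤c+T ⟩
      c + T + s′ * T   ≡⟨ +-assoc c T (s′ * T) ⟩
      c + (T + s′ * T) ≤⟨ room ⟩
      b                ∎

  extend : ∀ {d a c e b} → a < c → R a c → NoNeighbourIn R a c e → e ≤ b
         → InducedPath R d c e → InducedPath R (suc d) a b
  extend {d} {a} a<c Rac gap e≤b (A , induced) = P , induced′
    where
    P = prepend a<c (weaken e≤b A)

    head-adjacency : ∀ l → R a (at A l) ⇔ Consecutive zero (fsuc l)
    head-adjacency zero     = mk⇔ (λ _ → inj₁ refl) (λ _ → subst (R a) (≡-sym (at-zero A)) Rac)
    head-adjacency (fsuc l) =
      mk⇔ (λ Ral → contradiction Ral (gap (start<at-suc A l) (bounded A (fsuc l))))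
          (λ cons → contradiction cons ¬Consecutive-zero-suc-suc)

    R-flip : ∀ {i j} → R i j ⇔ R j i
    R-flip = mk⇔ R-sym R-sym

    induced′ : ∀ k l → R (at P k) (at P l) ⇔ Consecutive k l
    induced′ zero     zero     = loop-free a (zero {n = suc d})
    induced′ zero     (fsuc l) = head-adjacency l
    induced′ (fsuc k) zero     = Consecutive-sym ⇔-∘ (head-adjacency k ⇔-∘ R-flip)
    induced′ (fsuc k) (fsuc l) = ⇔-sym Consecutive-suc ⇔-∘ induced k l

  inducedPathOrManyLaterNeighbours : ∀ {L} → (∀ i → i < L → R i (suc i)) → ∀ s d a → a + suc s ^ d ≤ L
    → ManyLaterNeighbours R s L ⊎ InducedPath R d a (a + suc s ^ d)
  inducedPathOrManyLaterNeighbours _ _ zero a _ =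
    inj₂ (singleton (m≤m+n a 1) , λ { zero zero → loop-free a (zero {n = 0}) })
  inducedPathOrManyLaterNeighbours {L} path s (suc d) a a+τ^d+1≤L
    with neighbourChainOrGap s (τ ^ d) (n<1+n a) (path a a<L) room
    where
    τ = suc s
    a<L : a < L
    a<L = <-≤-trans (m<m+n a (m^n>0 τ (suc d))) a+τ^d+1≤L
    open ≤-Reasoning
    room : suc a + s * τ ^ d ≤ a + τ ^ suc d
    room = begin
      suc a + s * τ ^ d     ≡⟨ +-suc a (s * τ ^ d) ⟨
      a + suc (s * τ ^ d)   ≤⟨ +-monoʳ-≤ a (+-monoˡ-≤ (s * τ ^ d) (m^n>0 τ d)) ⟩
      a + (τ ^ d + s * τ ^ d) ∎
  ... | inj₁ (A , adj) = inj₁ (a , suc a , n<1+n a , weaken a+τ^d+1≤L A , adj)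
  ... | inj₂ g = map₂ (extend later adjacent gap room)
                      (inducedPathOrManyLaterNeighbours path s d neighbour (≤-trans room a+τ^d+1≤L))
    where open NeighbourBeforeGap g

module _ (G : Graph) {L : ℕ} (x : Fin (suc L) → Fin (n G)) where

  -- Positions beyond L wrap around; they are only ever used at positions ≤ L.
  position : ℕ → Fin (suc L)
  position i = i mod suc L

  toℕ-position : ∀ {i} → i ≤ L → toℕ (position i) ≡ i
  toℕ-position i≤L = trans (toℕ-fromℕ< _) (m≤n⇒m%n≡m i≤L)

  position-toℕ : ∀ j → position (toℕ j) ≡ j
  position-toℕ j = toℕ-injective (toℕ-position (toℕ≤pred[n] j))

  position-injective : ∀ {i j} → i ≤ L → j ≤ L → position i ≡ position j → i ≡ j
  position-injective i≤L j≤L eq =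
    trans (≡-sym (toℕ-position i≤L)) (trans (cong toℕ eq) (toℕ-position j≤L))

  AdjAt : ℕ → ℕ → Set
  AdjAt i j = Adj G (x (position i)) (x (position j))

  adjAt-path : (∀ (i : Fin L) → Adj G (x (inject₁ i)) (x (fsuc i))) → ∀ i → i < L → AdjAt i (suc i)
  adjAt-path edges i i<L =
    subst₂ AdjAt (trans (toℕ-inject₁ j) (toℕ-fromℕ< i<L)) (cong suc (toℕ-fromℕ< i<L))
      (subst₂ (λ u v → Adj G (x u) (x v))
        (≡-sym (position-toℕ (inject₁ j))) (≡-sym (position-toℕ (fsuc j))) (edges j))
    where j = fromℕ< i<L

  VertexWithLaterNeighbours : ℕ → Set
  VertexWithLaterNeighbours τ =
    Σ (Fin (suc L)) λ i₀ → Σ (Fin τ → Fin (suc L)) λ f →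
      Injective _≡_ _≡_ f × (∀ k → toℕ i₀ < toℕ (f k)) × (∀ k → Adj G (x i₀) (x (f k)))

  InducedPathFromStart : ℕ → Set
  InducedPathFromStart ρ =
    Σ (Fin (suc ρ) → Fin (suc L)) λ j →
      (j zero ≡ zero) × Increasing (toℕ ∘ j) × (∀ k l → Adj G (x (j k)) (x (j l)) ⇔ Consecutive k l)

  toVertexWithLaterNeighbours : ∀ {s} → ManyLaterNeighbours AdjAt s L → VertexWithLaterNeighbours (suc s)
  toVertexWithLaterNeighbours (a , c , a<c , A , adjacent) =
    position a , position ∘ at A ,
    (λ eq → increasing⇒injective (increasing A) (position-injective (bounded A _) (bounded A _) eq)) ,
    (λ k → subst₂ _<_ (≡-sym (toℕ-position a≤L)) (≡-sym (toℕ-position (bounded A k))) (a<at k)) ,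
    adjacent
    where
    a<at : ∀ k → a < at A k
    a<at k = <-≤-trans a<c (start≤at A k)
    a≤L : a ≤ L
    a≤L = <⇒≤ (<-≤-trans (a<at zero) (bounded A zero))

  toInducedPathFromStart : ∀ {ρ} → InducedPath AdjAt ρ 0 L → InducedPathFromStart ρ
  toInducedPathFromStart (A , induced) =
    position ∘ at A , cong position (at-zero A) ,
    (λ k l k<l → subst₂ _<_ (≡-sym (toℕ-position (bounded A k))) (≡-sym (toℕ-position (bounded A l)))
                             (increasing A k l k<l)) ,
    induced

lemma4p3 : (ρ τ : ℕ) → 1 ≤ ρ → 1 ≤ τ → (G : Graph)
    → (x : Fin (suc (τ ^ ρ)) → Fin (n G)) → IsPath G (τ ^ ρ) x
    → (Σ (Fin (suc (τ ^ ρ))) λ i₀ →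
         Σ (Fin τ → Fin (suc (τ ^ ρ))) λ f →
           Injective _≡_ _≡_ f
           × (∀ k → toℕ i₀ < toℕ (f k))
           × (∀ k → Adj G (x i₀) (x (f k))))
      ⊎
      (Σ (Fin (suc ρ) → Fin (suc (τ ^ ρ))) λ j →
         (j zero ≡ zero)
         × (∀ (k l : Fin (suc ρ)) → toℕ k < toℕ l → toℕ (j k) < toℕ (j l))
         × (∀ (k l : Fin (suc ρ)) →
              Adj G (x (j k)) (x (j l)) ⇔ (suc (toℕ k) ≡ toℕ l ⊎ suc (toℕ l) ≡ toℕ k)))
lemma4p3 ρ zero _ () G x _
lemma4p3 ρ (suc s) _ _ G x (_ , edges) =
  ⊎-map (toVertexWithLaterNeighbours G x) (toInducedPathFromStart G x)
    (inducedPathOrManyLaterNeighbours (λ i j → dec G _ _) (Graph.sym G) (λ _ → irrefl G _)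
      (adjAt-path G x edges) s ρ 0 ≤-refl)
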